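{- Let $V\subset\mathbb{R}^d$ be a finite antichain, $p\in S_V$, and $u,v\in D_p$ with $T_p(u)\subsetneq T_p(v)$. Let $i\in T_p(v)\setminus T_p(u)$. Then $v$ is not an $i$-witness for $p$.
   Context: $\mathbb{R}^d$ carries the dominance order ($x\le y$ iff $x_k\le y_k$ for all $k$). Write $x\rhd y$ if $x_k>y_k$ for all $k$, and $x\rhd_i y$ if $x_i=y_i$ and $x_j>y_j$ for all $j\neq i$. For a finite antichain $V$ (elements called minima), $S_V$ is the topological boundary of $\{x: x\ge v\text{ for some }v\in V\}$; equivalently $p\in S_V$ iff $p\ge v$ for some $v\in V$ and no $w\in V$ satisfies $p\rhd w$. For $p\in S_V$, $D_p=\{v\in V: v\le p\}$ and, for $v\in D_p$, $T_p(v)=\{k\in\{1,\dots,d\}: p_k=v_k\}$ (tight coordinates). A minimum $v\in D_p$ is an $i$-witness for $p$ if there exists $q\in S_V$ with $v\le p\le q$ and $q\rhd_i v$. -}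

module Defs where

open import Level using (Level; _⊔_)
open import Data.Nat using (ℕ)
open import Data.Fin using (Fin)
open import Data.List using (List)
open import Data.List.Membership.Propositional using (_∈_)
open import Data.Product using (_×_; ∃; ∃-syntax; Σ-syntax)
open import Data.Sum using (_⊎_)
open import Relation.Nullary using (¬_)
open import Relation.Binary.Bundles using (StrictTotalOrder)

-- The coordinate ring ℝ is replaced by an arbitrary strict total order
-- (ℝ with its usual < is an instance); only the order of ℝ is used.
module Dominance {c ℓ₁ ℓ₂ : Level} (S : StrictTotalOrder c ℓ₁ ℓ₂) where
  open StrictTotalOrder S renaming (Carrier to A)

  _≤ᶜ_ : A → A → Set (ℓ₁ ⊔ ℓ₂)
  a ≤ᶜ b = (a < b) ⊎ (a ≈ b)

  Point : ℕ → Set c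
  Point d = Fin d → A

  module _ {d : ℕ} where
    _≤ᵈ_ : Point d → Point d → Set (ℓ₁ ⊔ ℓ₂)
    x ≤ᵈ y = ∀ k → x k ≤ᶜ y k

    _▷_ : Point d → Point d → Set ℓ₂
    x ▷ y = ∀ k → y k < x k

    _▷[_]_ : Point d → Fin d → Point d → Set (ℓ₁ ⊔ ℓ₂)
    x ▷[ i ] y = (x i ≈ y i) × (∀ j → ¬ (j ≡ i) → y j < x j)
      where open import Relation.Binary.PropositionalEquality using (_≡_)

    _≋_ : Point d → Point d → Set ℓ₁
    x ≋ y = ∀ k → x k ≈ y k

    Antichain : List (Point d) → Set (c ⊔ ℓ₁ ⊔ ℓ₂)
    Antichain V = ∀ v w → v ∈ V → w ∈ V → v ≤ᵈ w → v ≋ w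

    InS : List (Point d) → Point d → Set (c ⊔ ℓ₁ ⊔ ℓ₂)
    InS V p = (∃[ v ] (v ∈ V × v ≤ᵈ p)) × (∀ w → w ∈ V → ¬ (p ▷ w))

    InD : List (Point d) → Point d → Point d → Set (c ⊔ ℓ₁ ⊔ ℓ₂)
    InD V p v = v ∈ V × v ≤ᵈ p

    Tight : Point d → Point d → Fin d → Set ℓ₁
    Tight p v k = p k ≈ v k

    TightSubsetStrict : Point d → Point d → Point d → Set ℓ₁
    TightSubsetStrict p u v =
      (∀ k → Tight p u k → Tight p v k) × (∃[ k ] (Tight p v k × ¬ Tight p u k))

    IsWitness : List (Point d) → Fin d → Point d → Point d → Set (c ⊔ ℓ₁ ⊔ ℓ₂)
    IsWitness V i p v =
      InD V p v × (∃[ q ] (InS V q × v ≤ᵈ p × p ≤ᵈ q × q ▷[ i ] v))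

-- A witness q with q ▷ᵢ v strictly dominates u: off the tight set of u we have
-- uₖ < pₖ ≤ qₖ; on it (which excludes i) uₖ ≈ pₖ ≈ vₖ < qₖ because T_p(u) ⊆ T_p(v).
-- Then q ∈ S_V is strictly above the minimum u, which S_V forbids.
module Submission where

open import Defs
open import Level using (Level)
open import Data.Nat using (ℕ)
open import Data.Fin using (Fin; _≟_)
open import Data.List using (List)
open import Data.Product using (_,_)
open import Data.Sum using (inj₁; inj₂)
open import Data.Empty using (⊥-elim)
open import Relation.Nullary using (¬_; yes; no)
open import Relation.Binary.Bundles using (StrictTotalOrder)
open import Relation.Binary.PropositionalEquality using (refl)

module _ {c ℓ₁ ℓ₂ : Level} (S : StrictTotalOrder c ℓ₁ ℓ₂) where
  open StrictTotalOrder S using (_<_; _≈_; trans; <-respʳ-≈; <-respˡ-≈; module Eq)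
  open Dominance S

  <-≤ᶜ-trans : ∀ {a b e} → a < b → b ≤ᶜ e → a < e
  <-≤ᶜ-trans a<b (inj₁ b<e) = trans a<b b<e
  <-≤ᶜ-trans a<b (inj₂ b≈e) = <-respʳ-≈ b≈e a<b

  ▷ᵢ-dominates-less-tight : ∀ {d} {p q u v : Point d} {i : Fin d} →
    u ≤ᵈ p → p ≤ᵈ q → q ▷[ i ] v →
    (∀ k → Tight p u k → Tight p v k) → ¬ Tight p u i →
    q ▷ u
  ▷ᵢ-dominates-less-tight {p = p} {q} {u} {v} {i} u≤p p≤q (_ , q>v) tight⊆ ¬tightᵢ k
    with u≤p k
  ... | inj₁ uₖ<pₖ = <-≤ᶜ-trans uₖ<pₖ (p≤q k)
  ... | inj₂ uₖ≈pₖ with k ≟ i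
  ...   | yes refl = ⊥-elim (¬tightᵢ (Eq.sym uₖ≈pₖ))
  ...   | no k≢i = <-respˡ-≈ vₖ≈uₖ (q>v k k≢i)
    where
    vₖ≈uₖ : v k ≈ u k
    vₖ≈uₖ = Eq.trans (Eq.sym (tight⊆ k (Eq.sym uₖ≈pₖ))) (Eq.sym uₖ≈pₖ)

mainTheorem4 : ∀ {c ℓ₁ ℓ₂ : Level} (S : StrictTotalOrder c ℓ₁ ℓ₂) → let open Dominance S in
    ∀ (d : ℕ) (V : List (Point d)) → Antichain V →
    ∀ (p : Point d) → InS V p →
    ∀ (u v : Point d) → InD V p u → InD V p v → TightSubsetStrict p u v →
    ∀ (i : Fin d) → Tight p v i → ¬ Tight p u i →
    ¬ IsWitness V i p v
mainTheorem4 S d V _ p _ u v (u∈V , u≤p) _ (tight⊆ , _) i _ ¬tightᵢ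
  (_ , q , (_ , q-not-above-minima) , _ , p≤q , q▷ᵢv) =
  q-not-above-minima u u∈V (▷ᵢ-dominates-less-tight S u≤p p≤q q▷ᵢv tight⊆ ¬tightᵢ)
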